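{- Let $r,\sigma,\delta,m$ be positive integers with $r\ge 2$, and let $\phi: W_r(m,\sigma,\delta)\to W_r(m,\sigma,\delta-1)$ be the map $\langle \alpha, A_1, \ldots, A_{\delta} \rangle\mapsto\langle \alpha, A_1, \ldots, A_{\delta-1} \rangle$. For every $\mathcal A \in V(W_r(m,\sigma,\delta))$, we have $|\phi(N(\mathcal A))| \leq 2^{r^{\sigma+\delta-2}(r+1)}$.
   Context: The graph $W_r(m,\sigma,\delta)$ has vertex set all tuples $\langle\alpha,A_1,\dots,A_\delta\rangle$ with $\alpha\in A_1\subset A_2\subset\cdots\subset A_\delta\subseteq[m]$ and $|A_i|=r^{i-1}\cdot r^{\sigma}$ for $1\le i\le\delta$; two vertices $\langle\alpha,A_1,\dots,A_\delta\rangle$, $\langle\beta,B_1,\dots,B_\delta\rangle$ are adjacent iff $\alpha\neq\beta$, $\alpha\in B_1$, $\beta\in A_1$, and $A_i\subseteq B_{i+1}$, $B_i\subseteq A_{i+1}$ for all $1\le i\le\delta-1$. $N(\mathcal A)$ is the set of neighbours of $\mathcal A$ and $\phi(X)=\{\phi(x):x\in X\}$. -}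

module Defs where

open import Data.Nat using (ℕ; zero; suc; _^_; _*_)
open import Data.Fin using (Fin; toℕ)
open import Data.Fin.Subset using (Subset; _∈_; _⊆_; ∣_∣)
open import Data.Vec using (Vec; lookup; init)
open import Data.Product using (_×_; _,_; Σ; ∃)
open import Relation.Binary.PropositionalEquality using (_≡_; _≢_)

-- A tuple ⟨α, A₁, …, A_δ⟩ with α ∈ [m] (= Fin m) and A_i ⊆ [m].
-- The set A_{i+1} (paper index, 1-based) is  lookup As i  (i : Fin δ, 0-based).
Tuple : ℕ → ℕ → Set
Tuple m δ = Fin m × Vec (Subset m) δ

IsVertex : (r m σ δ : ℕ) → Tuple m δ → Set
IsVertex r m σ δ (α , As) =
  (∀ (i : Fin δ) → toℕ i ≡ 0 → α ∈ lookup As i) ×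
  (∀ (i j : Fin δ) → toℕ j ≡ suc (toℕ i) → lookup As i ⊆ lookup As j) ×
  (∀ (i : Fin δ) → ∣ lookup As i ∣ ≡ r ^ toℕ i * r ^ σ)

Adjacent : (m δ : ℕ) → Tuple m δ → Tuple m δ → Set
Adjacent m δ (α , As) (β , Bs) =
  α ≢ β ×
  (∀ (i : Fin δ) → toℕ i ≡ 0 → α ∈ lookup Bs i) ×
  (∀ (i : Fin δ) → toℕ i ≡ 0 → β ∈ lookup As i) ×
  (∀ (i j : Fin δ) → toℕ j ≡ suc (toℕ i) →
     (lookup As i ⊆ lookup Bs j) × (lookup Bs i ⊆ lookup As j))

InNbhd : (r m σ δ : ℕ) → Tuple m δ → Tuple m δ → Set
InNbhd r m σ δ 𝓐 𝓑 = IsVertex r m σ δ 𝓑 × Adjacent m δ 𝓐 𝓑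

φ : {m d : ℕ} → Tuple m (suc d) → Tuple m d
φ (α , As) = α , init As

InImage : (r m σ d : ℕ) → Tuple m (suc d) → Tuple m d → Set
InImage r m σ d 𝓐 x = Σ (Tuple m (suc d)) λ 𝓑 → InNbhd r m σ (suc d) 𝓐 𝓑 × φ 𝓑 ≡ x

module Submission where

-- Fix x ∈ [m] and read, at x, the chain A₁ ⊆ ⋯ ⊆ A_δ and a point ⟨β, B₁, …, B_{δ-1}⟩ of
-- φ(N(𝓐)) with B₀ = {β} put in front.  If x enters the chain at A_k, then x ∉ B_j for
-- j < k - 1 (as B_j ⊆ A_{j+1}) and x ∈ B_j for j > k (as A_k ⊆ B_{k+1} ⊆ B_j), so the point
-- is determined by the two bits "x ∈ B_{k-1}" and "x ∈ B_k" for all x.  The first bit can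
-- only be set for x ∈ A_δ and the second only for x ∈ A_{δ-1}, so φ(N(𝓐)) injects into the
-- subsets of a set of size |A_δ| + |A_{δ-1}| ≤ r^{σ+δ-2}(r+1).

open import Defs
open import Data.Nat using (ℕ; zero; suc; _^_; _*_; _+_; _∸_; _≤_; z≤n; s≤s)
open import Data.Nat.Properties
  using (+-suc; +-identityʳ; +-comm; *-comm; *-identityʳ; *-distribˡ-+; ^-distribˡ-+-*; ^-monoʳ-≤;
         +-monoʳ-≤; ≤-reflexive; module ≤-Reasoning)
import Data.Bool.Base as Bool
open import Data.Bool.Base using (Bool; true; false; f≤t; b≤b)
open import Data.Bool.Properties using (≤-minimum; ≤-maximum) renaming (≤-trans to ≤ᵇ-trans)
open import Data.Fin using (Fin; zero; suc; toℕ; fromℕ; inject₁)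
open import Data.Fin.Properties using (toℕ-fromℕ; toℕ-inject₁)
open import Data.Fin.Subset using (Subset; _⊆_; ⁅_⁆; ⊥; ∣_∣) renaming (_∈_ to _∈ˢ_)
open import Data.Fin.Subset.Properties using (x∈⁅x⁆; x∈⁅y⁆⇒x≡y; ∣⊥∣≡0)
open import Data.List using (List; []; _∷_; _++_; [_]; length; map)
open import Data.List.Properties using (length-++; length-map)
open import Data.List.Membership.Propositional using (_∈_)
open import Data.List.Membership.Propositional.Properties using (∈-∃++; ∈-map⁺; ∈-++⁺ˡ; ∈-++⁺ʳ)
open import Data.List.Relation.Unary.Any using (here; there)
open import Data.List.Relation.Unary.All using (All; []; _∷_)
import Data.List.Relation.Unary.All as All
open import Data.List.Relation.Unary.AllPairs using (_∷_)
open import Data.List.Relation.Unary.Unique.Propositional using (Unique)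
open import Data.Vec using (Vec; []; _∷_; head; tail; init; lookup; tabulate; replicate)
  renaming (_++_ to _++ᵛ_; map to mapᵛ)
open import Data.Vec.Properties
  using (lookup-map; lookup-replicate; tabulate∘lookup; ++-injectiveˡ; ++-injectiveʳ;
         ∷-injectiveˡ; ∷-injectiveʳ; []=⇒lookup; lookup⇒[]=)
open import Data.Vec.Relation.Binary.Pointwise.Inductive
  using (Pointwise; []; _∷_; ++⁺; tabulate⁺; tabulate⁻; ≡⇒Pointwise-≡; Pointwise-≡⇒≡)
open import Data.Vec.Relation.Binary.Pointwise.Extensional using (ext; extensional⇒inductive)
open import Data.Product using (_×_; _,_; proj₁; proj₂; ∃)
open import Data.Product.Properties using (×-≡,≡→≡)
open import Function using (_∘_)
open import Relation.Nullary using (contradiction)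
open import Relation.Binary.PropositionalEquality
  using (_≡_; _≢_; refl; sym; trans; cong; cong₂; subst; subst₂; module ≡-Reasoning)

∈-delete : ∀ {A : Set} {y v : A} (us : List A) {vs : List A} →
           y ∈ us ++ v ∷ vs → y ≢ v → y ∈ us ++ vs
∈-delete []       (here y≡v)    y≢v = contradiction y≡v y≢v
∈-delete []       (there y∈vs)  _   = y∈vs
∈-delete (u ∷ us) (here y≡u)    _   = here y≡u
∈-delete (u ∷ us) (there y∈us+) y≢v = there (∈-delete us y∈us+ y≢v)

length-insert : ∀ {A : Set} (us : List A) {v : A} {vs : List A} →
                length (us ++ v ∷ vs) ≡ suc (length (us ++ vs))
length-insert us {v} {vs} = begin
  length (us ++ v ∷ vs)            ≡⟨ length-++ us ⟩
  length us + suc (length vs)      ≡⟨ +-suc (length us) (length vs) ⟩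
  suc (length us + length vs)      ≡⟨ cong suc (length-++ us) ⟨
  suc (length (us ++ vs))          ∎
  where open ≡-Reasoning

length≤-injective : ∀ {A B : Set} {P : A → Set} (f : A → B) →
                    (∀ {x y} → P x → P y → f x ≡ f y → x ≡ y) →
                    ∀ {xs ys} → Unique xs → All P xs → All (λ x → f x ∈ ys) xs →
                    length xs ≤ length ys
length≤-injective f inj {[]} _ _ _ = z≤n
length≤-injective f inj {x ∷ xs} (x≢xs ∷ unique) (px ∷ pxs) (fx∈ys ∷ fxs∈ys)
  with ∈-∃++ fx∈ys
... | us , vs , refl = begin
  suc (length xs)                  ≤⟨ s≤s (length≤-injective f inj unique pxs fxs∈us+vs) ⟩
  suc (length (us ++ vs))          ≡⟨ length-insert us ⟨
  length (us ++ f x ∷ vs)          ∎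
  where
  open ≤-Reasoning
  fxs≢fx : All (λ y → f y ≢ f x) xs
  fxs≢fx = All.zipWith (λ (x≢y , py) fy≡fx → x≢y (inj px py (sym fy≡fx))) (x≢xs , pxs)
  fxs∈us+vs : All (λ y → f y ∈ us ++ vs) xs
  fxs∈us+vs = All.zipWith (λ (fy∈ , fy≢fx) → ∈-delete us fy∈ fy≢fx) (fxs∈ys , fxs≢fx)

subsetsOf : ∀ {n} → Subset n → List (Subset n)
subsetsOf []          = [ [] ]
subsetsOf (false ∷ T) = map (false ∷_) (subsetsOf T)
subsetsOf (true ∷ T)  = map (false ∷_) (subsetsOf T) ++ map (true ∷_) (subsetsOf T)

length-subsetsOf : ∀ {n} (T : Subset n) → length (subsetsOf T) ≡ 2 ^ ∣ T ∣
length-subsetsOf []          = refl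
length-subsetsOf (false ∷ T) = trans (length-map _ (subsetsOf T)) (length-subsetsOf T)
length-subsetsOf (true ∷ T)  = begin
  length (map (false ∷_) S ++ map (true ∷_) S)          ≡⟨ length-++ (map (false ∷_) S) ⟩
  length (map (false ∷_) S) + length (map (true ∷_) S)  ≡⟨ cong₂ _+_ (length-map _ S) (length-map _ S) ⟩
  length S + length S                                   ≡⟨ cong₂ _+_ (length-subsetsOf T) (length-subsetsOf T) ⟩
  2 ^ ∣ T ∣ + 2 ^ ∣ T ∣                                 ≡⟨ cong (2 ^ ∣ T ∣ +_) (+-identityʳ _) ⟨
  2 ^ ∣ T ∣ + (2 ^ ∣ T ∣ + 0)                           ∎
  where
  open ≡-Reasoning
  S = subsetsOf T

∈-subsetsOf : ∀ {n} {p T : Subset n} → Pointwise Bool._≤_ p T → p ∈ subsetsOf T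
∈-subsetsOf []                          = here refl
∈-subsetsOf (f≤t ∷ p≤T)                 = ∈-++⁺ˡ (∈-map⁺ (false ∷_) (∈-subsetsOf p≤T))
∈-subsetsOf (b≤b {false} ∷ p≤T)         = ∈-map⁺ (false ∷_) (∈-subsetsOf p≤T)
∈-subsetsOf {T = true ∷ T} (b≤b ∷ p≤T) =
  ∈-++⁺ʳ (map (false ∷_) (subsetsOf T)) (∈-map⁺ (true ∷_) (∈-subsetsOf p≤T))

∣p++q∣≡∣p∣+∣q∣ : ∀ {m n} (p : Subset m) (q : Subset n) → ∣ p ++ᵛ q ∣ ≡ ∣ p ∣ + ∣ q ∣
∣p++q∣≡∣p∣+∣q∣ []          q = refl
∣p++q∣≡∣p∣+∣q∣ (true ∷ p)  q = cong suc (∣p++q∣≡∣p∣+∣q∣ p q)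
∣p++q∣≡∣p∣+∣q∣ (false ∷ p) q = ∣p++q∣≡∣p∣+∣q∣ p q

Ascending : ∀ {n} → Vec Bool (suc n) → Set
Ascending v = Pointwise Bool._≤_ (init v) (tail v)

head≤lookup : ∀ {n} {v : Vec Bool (suc n)} → Ascending v → ∀ i → head v Bool.≤ lookup v i
head≤lookup {v = _ ∷ _}     _                 zero    = b≤b
head≤lookup {v = _ ∷ _ ∷ _} (x≤y ∷ ascending) (suc i) = ≤ᵇ-trans x≤y (head≤lookup ascending i)

ascending-true⇒replicate : ∀ {n} {v : Vec Bool (suc n)} → Ascending v → true Bool.≤ head v →
                           v ≡ replicate (suc n) true
ascending-true⇒replicate {v = _ ∷ []}    _                 b≤b = refl
ascending-true⇒replicate {v = _ ∷ _ ∷ _} (t≤y ∷ ascending) b≤b =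
  cong (true ∷_) (ascending-true⇒replicate ascending t≤y)

-- With k the first position where a is true (k = n if there is none),
-- code a c = (c k, c (k + 1)), reading c (n + 1) as false.
code : ∀ {n} → Vec Bool (suc n) → Vec Bool (suc n) → Bool × Bool
code (_ ∷ [])          (c ∷ [])      = c , false
code (true ∷ _ ∷ _)    (c ∷ c′ ∷ _)  = c , c′
code (false ∷ a′ ∷ as) (_ ∷ c′ ∷ cs) = code (a′ ∷ as) (c′ ∷ cs)

-- At a point x: a and b are the columns of the sets of 𝓐 and of a neighbour 𝓑 = ⟨β, B⟩,
-- and c is the column of ⁅ β ⁆ ∷ init B.
record Interlaced {n} (a c b : Vec Bool (suc n)) : Set where
  constructor interlaced
  field
    tail≡init : tail c ≡ init b
    below     : Pointwise Bool._≤_ c a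
    above     : Pointwise Bool._≤_ (init a) (tail b)
    ascending : Ascending b

Interlaced-tail : ∀ {n} {a a′ c c′ b b′} {as cs bs : Vec Bool n} →
                  Interlaced (a ∷ a′ ∷ as) (c ∷ c′ ∷ cs) (b ∷ b′ ∷ bs) →
                  Interlaced (a′ ∷ as) (c′ ∷ cs) (b′ ∷ bs)
Interlaced-tail (interlaced eq (_ ∷ below) (_ ∷ above) (_ ∷ ascending)) =
  interlaced (∷-injectiveʳ eq) below above ascending

code-injective : ∀ {n} {a c c′ b b′ : Vec Bool (suc n)} →
                 Interlaced a c b → Interlaced a c′ b′ → code a c ≡ code a c′ → c ≡ c′
code-injective {a = _ ∷ []} {_ ∷ []} {_ ∷ []} _ _ same = cong (_∷ []) (cong proj₁ same)
code-injective {a = true ∷ _ ∷ _} {_ ∷ _ ∷ cs} {_ ∷ _ ∷ cs′} {_ ∷ b₂ ∷ bs} {_ ∷ b₂′ ∷ bs′}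
  (interlaced cs≡ _ (t≤b₂ ∷ _) (_ ∷ ascending)) (interlaced cs′≡ _ (t≤b₂′ ∷ _) (_ ∷ ascending′))
  same =
  cong₂ _∷_ (cong proj₁ same) (cong₂ _∷_ (cong proj₂ same) (begin
    cs                       ≡⟨ ∷-injectiveʳ cs≡ ⟩
    init (b₂ ∷ bs)           ≡⟨ cong init (ascending-true⇒replicate ascending t≤b₂) ⟩
    init (replicate _ true)  ≡⟨ cong init (ascending-true⇒replicate ascending′ t≤b₂′) ⟨
    init (b₂′ ∷ bs′)         ≡⟨ ∷-injectiveʳ cs′≡ ⟨
    cs′                      ∎))
  where open ≡-Reasoning
code-injective {a = false ∷ _ ∷ _} {_ ∷ _ ∷ _} {_ ∷ _ ∷ _} {_ ∷ _ ∷ _} {_ ∷ _ ∷ _}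
  I@(interlaced _ (b≤b ∷ _) _ _) I′@(interlaced _ (b≤b ∷ _) _ _) same =
  cong (false ∷_) (code-injective (Interlaced-tail I) (Interlaced-tail I′) same)

code-bounded : ∀ {n} {a c : Vec Bool (suc n)} {a₀} → Ascending a → Pointwise Bool._≤_ c a →
               proj₁ (code a c) Bool.≤ lookup a (fromℕ n) ×
               proj₂ (code a c) Bool.≤ lookup (a₀ ∷ a) (inject₁ (fromℕ n))
code-bounded {a = _ ∷ []} {_ ∷ []} _ (c≤a ∷ []) = c≤a , ≤-minimum _
code-bounded {suc n} {a@(true ∷ _ ∷ _)} {c ∷ c′ ∷ _} ascending _ =
  ≤ᵇ-trans (≤-maximum c) (head≤lookup {v = a} ascending (fromℕ (suc n))) ,
  ≤ᵇ-trans (≤-maximum c′) (head≤lookup {v = a} ascending (inject₁ (fromℕ n)))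
code-bounded {a = false ∷ _ ∷ _} {_ ∷ _ ∷ _} (_ ∷ ascending) (_ ∷ c≤a) =
  code-bounded ascending c≤a

column : ∀ {m n} → Fin m → Vec (Subset m) n → Vec Bool n
column x = mapᵛ (λ A → lookup A x)

lookup-column : ∀ {m n} (x : Fin m) (Cs : Vec (Subset m) n) i →
                lookup (column x Cs) i ≡ lookup (lookup Cs i) x
lookup-column x Cs i = lookup-map i _ Cs

init-map : ∀ {A B : Set} {n} (f : A → B) (v : Vec A (suc n)) → init (mapᵛ f v) ≡ mapᵛ f (init v)
init-map f (_ ∷ [])     = refl
init-map f (x ∷ y ∷ ys) = cong (f x ∷_) (init-map f (y ∷ ys))

columns-determine : ∀ {m n} {Cs Cs′ : Vec (Subset m) n} →
                    (∀ x → column x Cs ≡ column x Cs′) → Cs ≡ Cs′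
columns-determine {Cs = []}    {[]}    _    = refl
columns-determine {Cs = _ ∷ _} {_ ∷ _} same =
  cong₂ _∷_ (Pointwise-≡⇒≡ (extensional⇒inductive (ext (∷-injectiveˡ ∘ same))))
            (columns-determine (∷-injectiveʳ ∘ same))

⊆⇒lookup≤ : ∀ {m} {p q : Subset m} {x} → p ⊆ q → lookup p x Bool.≤ lookup q x
⊆⇒lookup≤ {p = p} {q} {x} p⊆q with lookup p x in x∈p
... | false = ≤-minimum _
... | true  = subst (true Bool.≤_) (sym ([]=⇒lookup (p⊆q (lookup⇒[]= x p x∈p)))) b≤b

tabulate-≤ : ∀ {n} {f : Fin n → Bool} {T : Subset n} →
             (∀ x → f x Bool.≤ lookup T x) → Pointwise Bool._≤_ (tabulate f) T
tabulate-≤ {T = T} f≤T = subst (Pointwise _ _) (tabulate∘lookup T) (tabulate⁺ f≤T)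

shifted⁺ : ∀ {A B : Set} {R : A → B → Set} {n} {xs : Vec A (suc n)} {ys : Vec B (suc n)} →
           (∀ i j → toℕ j ≡ suc (toℕ i) → R (lookup xs i) (lookup ys j)) →
           Pointwise R (init xs) (tail ys)
shifted⁺ {xs = _ ∷ []}    {_ ∷ []}    _ = []
shifted⁺ {xs = _ ∷ _ ∷ _} {_ ∷ _ ∷ _} R-next =
  R-next zero (suc zero) refl ∷
  shifted⁺ {xs = _ ∷ _} {_ ∷ _} (λ i j j≡1+i → R-next (suc i) (suc j) (cong suc j≡1+i))

column-shifted : ∀ {m n} (Cs Ds : Vec (Subset m) (suc n)) →
                 (∀ i j → toℕ j ≡ suc (toℕ i) → lookup Cs i ⊆ lookup Ds j) →
                 ∀ x → Pointwise Bool._≤_ (init (column x Cs)) (tail (column x Ds))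
column-shifted Cs Ds Cs⊆Ds x = shifted⁺ {xs = column x Cs} {column x Ds} λ i j j≡1+i →
  subst₂ Bool._≤_ (sym (lookup-column x Cs i)) (sym (lookup-column x Ds j))
         (⊆⇒lookup≤ (Cs⊆Ds i j j≡1+i))

flatten : ∀ {m n} → Tuple m n → Vec (Subset m) (suc n)
flatten (β , Cs) = ⁅ β ⁆ ∷ Cs

flatten-injective : ∀ {m n} {𝓒 𝓒′ : Tuple m n} → flatten 𝓒 ≡ flatten 𝓒′ → 𝓒 ≡ 𝓒′
flatten-injective {𝓒 = β , _} {β′ , _} eq =
  cong₂ _,_ (x∈⁅y⁆⇒x≡y β′ (subst (β ∈ˢ_) (∷-injectiveˡ eq) (x∈⁅x⁆ β))) (∷-injectiveʳ eq)

neighbour-interlaced : ∀ {r σ m d} {𝓐 𝓑 : Tuple m (suc d)} → InNbhd r m σ (suc d) 𝓐 𝓑 →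
                       ∀ x → Interlaced (column x (proj₂ 𝓐)) (column x (flatten (φ 𝓑)))
                                         (column x (proj₂ 𝓑))
neighbour-interlaced {𝓐 = _ , A ∷ As} {β , Bs} ((_ , B-chain , _) , (_ , _ , β∈A₁ , A⇄B)) x =
  interlaced (sym (init-map _ Bs))
             (⊆⇒lookup≤ ⁅β⁆⊆A ∷ subst (λ c → Pointwise _ c _) (init-map _ Bs) B≤A)
             (column-shifted (A ∷ As) Bs (λ i j e → proj₁ (A⇄B i j e)) x)
             (column-shifted Bs Bs B-chain x)
  where
  B≤A = column-shifted Bs (A ∷ As) (λ i j e → proj₂ (A⇄B i j e)) x
  ⁅β⁆⊆A : ⁅ β ⁆ ⊆ A
  ⁅β⁆⊆A y∈⁅β⁆ = subst (_∈ˢ A) (sym (x∈⁅y⁆⇒x≡y β y∈⁅β⁆)) (β∈A₁ zero refl)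

codeAt : ∀ {m n} → Vec (Subset m) (suc n) → Vec (Subset m) (suc n) → Fin m → Bool × Bool
codeAt As Cs x = code (column x As) (column x Cs)

encode : ∀ {m n} → Vec (Subset m) (suc n) → Vec (Subset m) (suc n) → Subset (m + m)
encode As Cs = tabulate (proj₁ ∘ codeAt As Cs) ++ᵛ tabulate (proj₂ ∘ codeAt As Cs)

encode-≡⇒codeAt-≡ : ∀ {m n} (As Cs Cs′ : Vec (Subset m) (suc n)) →
                    encode As Cs ≡ encode As Cs′ → ∀ x → codeAt As Cs x ≡ codeAt As Cs′ x
encode-≡⇒codeAt-≡ _ _ _ same x = ×-≡,≡→≡
  ( tabulate⁻ (≡⇒Pointwise-≡ (++-injectiveˡ _ _ same)) x
  , tabulate⁻ (≡⇒Pointwise-≡ (++-injectiveʳ _ _ same)) x )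

-- A_δ and A_{δ-1} side by side, with A₀ read as ∅.
lastTwo : ∀ {m d} → Vec (Subset m) (suc d) → Subset (m + m)
lastTwo {d = d} As = lookup As (fromℕ d) ++ᵛ lookup (⊥ ∷ As) (inject₁ (fromℕ d))

module _ (r σ : ℕ) {m d : ℕ} (α : Fin m) (As : Vec (Subset m) (suc d)) where

  image-interlaced : ∀ {𝓒} → InImage r m σ d (α , As) 𝓒 →
                     ∀ x → ∃ (Interlaced (column x As) (column x (flatten 𝓒)))
  image-interlaced (_ , neighbour , refl) x = _ , neighbour-interlaced {r} {σ} neighbour x

  encode-injective : ∀ {𝓒 𝓒′} → InImage r m σ d (α , As) 𝓒 → InImage r m σ d (α , As) 𝓒′ →
                     encode As (flatten 𝓒) ≡ encode As (flatten 𝓒′) → 𝓒 ≡ 𝓒′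
  encode-injective {𝓒} {𝓒′} 𝓒∈ 𝓒′∈ same = flatten-injective (columns-determine λ x →
    code-injective (proj₂ (image-interlaced 𝓒∈ x)) (proj₂ (image-interlaced 𝓒′∈ x))
                   (encode-≡⇒codeAt-≡ As (flatten 𝓒) (flatten 𝓒′) same x))

  encode-bounded : IsVertex r m σ (suc d) (α , As) → ∀ {𝓒} → InImage r m σ d (α , As) 𝓒 →
                   Pointwise Bool._≤_ (encode As (flatten 𝓒)) (lastTwo As)
  encode-bounded (_ , A-chain , _) 𝓒∈ = ++⁺
    (tabulate-≤ {T = lookup As (fromℕ d)} λ x →
      subst₂ Bool._≤_ refl (lookup-column x As (fromℕ d)) (proj₁ (bounds x)))
    (tabulate-≤ {T = lookup (⊥ ∷ As) (inject₁ (fromℕ d))} λ x →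
      subst₂ Bool._≤_ refl (lookup-column x (⊥ ∷ As) (inject₁ (fromℕ d))) (proj₂ (bounds x)))
    where
    bounds = λ x → code-bounded (column-shifted As As A-chain x)
                                (Interlaced.below (proj₂ (image-interlaced 𝓒∈ x)))

r^i*r^[1+s]≡r^[s+i]*r : ∀ r s i → r ^ i * r ^ suc s ≡ r ^ (s + i) * r
r^i*r^[1+s]≡r^[s+i]*r r s i = begin
  r ^ i * r ^ suc s   ≡⟨ ^-distribˡ-+-* r i (suc s) ⟨
  r ^ (i + suc s)     ≡⟨ cong (r ^_) (trans (+-suc i s) (cong suc (+-comm i s))) ⟩
  r * r ^ (s + i)     ≡⟨ *-comm r _ ⟩
  r ^ (s + i) * r     ∎
  where open ≡-Reasoning

module _ (r s : ℕ) {m : ℕ} where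

  ∣last∣≡ : ∀ {d} (As : Vec (Subset m) (suc d)) →
            (∀ i → ∣ lookup As i ∣ ≡ r ^ toℕ i * r ^ suc s) →
            ∣ lookup As (fromℕ d) ∣ ≡ r ^ (s + d) * r
  ∣last∣≡ {d} As sizes = begin
    ∣ lookup As (fromℕ d) ∣          ≡⟨ sizes (fromℕ d) ⟩
    r ^ toℕ (fromℕ d) * r ^ suc s    ≡⟨ cong (λ i → r ^ i * r ^ suc s) (toℕ-fromℕ d) ⟩
    r ^ d * r ^ suc s                ≡⟨ r^i*r^[1+s]≡r^[s+i]*r r s d ⟩
    r ^ (s + d) * r                  ∎
    where open ≡-Reasoning

  ∣penultimate∣≤ : ∀ {d} (As : Vec (Subset m) (suc d)) →
                   (∀ i → ∣ lookup As i ∣ ≡ r ^ toℕ i * r ^ suc s) →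
                   ∣ lookup (⊥ ∷ As) (inject₁ (fromℕ d)) ∣ ≤ r ^ (s + d)
  ∣penultimate∣≤ {zero}  _  _     = subst (_≤ _) (sym (∣⊥∣≡0 m)) z≤n
  ∣penultimate∣≤ {suc d} As sizes = ≤-reflexive (begin
    ∣ lookup As (inject₁ (fromℕ d)) ∣        ≡⟨ sizes (inject₁ (fromℕ d)) ⟩
    r ^ toℕ (inject₁ (fromℕ d)) * r ^ suc s  ≡⟨ cong (λ i → r ^ i * r ^ suc s)
                                                     (trans (toℕ-inject₁ (fromℕ d)) (toℕ-fromℕ d)) ⟩
    r ^ d * r ^ suc s                        ≡⟨ r^i*r^[1+s]≡r^[s+i]*r r s d ⟩
    r ^ (s + d) * r                          ≡⟨ *-comm _ r ⟩
    r ^ suc (s + d)                          ≡⟨ cong (r ^_) (+-suc s d) ⟨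
    r ^ (s + suc d)                          ∎)
    where open ≡-Reasoning

  ∣lastTwo∣≤ : ∀ {d} (As : Vec (Subset m) (suc d)) →
               (∀ i → ∣ lookup As i ∣ ≡ r ^ toℕ i * r ^ suc s) →
               ∣ lastTwo As ∣ ≤ r ^ (suc s + suc d ∸ 2) * (r + 1)
  ∣lastTwo∣≤ {d} As sizes = begin
    ∣ lastTwo As ∣                           ≡⟨ ∣p++q∣≡∣p∣+∣q∣ (lookup As (fromℕ d)) _ ⟩
    ∣ lookup As (fromℕ d) ∣ + ∣ lookup (⊥ ∷ As) (inject₁ (fromℕ d)) ∣
                                             ≤⟨ +-monoʳ-≤ _ (∣penultimate∣≤ As sizes) ⟩
    ∣ lookup As (fromℕ d) ∣ + r ^ (s + d)    ≡⟨ cong (_+ r ^ (s + d)) (∣last∣≡ As sizes) ⟩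
    r ^ (s + d) * r + r ^ (s + d)            ≡⟨ cong (r ^ (s + d) * r +_) (*-identityʳ _) ⟨
    r ^ (s + d) * r + r ^ (s + d) * 1        ≡⟨ *-distribˡ-+ (r ^ (s + d)) r 1 ⟨
    r ^ (s + d) * (r + 1)                    ≡⟨ cong (λ k → r ^ (k ∸ 1) * (r + 1)) (+-suc s d) ⟨
    r ^ (suc s + suc d ∸ 2) * (r + 1)        ∎
    where open ≤-Reasoning

lemmaA1 : (r σ d m : ℕ) → 2 ≤ r → 1 ≤ σ → 1 ≤ m →
          (𝓐 : Tuple m (suc d)) → IsVertex r m σ (suc d) 𝓐 →
          (L : List (Tuple m d)) → Unique L → All (InImage r m σ d 𝓐) L →
          length L ≤ 2 ^ (r ^ (σ + suc d ∸ 2) * (r + 1))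
lemmaA1 r (suc s) d _ _ _ _ (α , As) vertex@(_ , _ , sizes) L unique images = begin
  length L                          ≤⟨ length≤-injective (encode As ∘ flatten) (encode-injective r (suc s) α As)
                                         unique images (All.map (∈-subsetsOf ∘ encode-bounded r (suc s) α As vertex) images) ⟩
  length (subsetsOf (lastTwo As))   ≡⟨ length-subsetsOf (lastTwo As) ⟩
  2 ^ ∣ lastTwo As ∣                 ≤⟨ ^-monoʳ-≤ 2 (∣lastTwo∣≤ r s As sizes) ⟩
  2 ^ (r ^ (suc s + suc d ∸ 2) * (r + 1)) ∎
  where open ≤-Reasoning
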